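{- For every $n\ge1$, the saillance code $\operatorname{Sc}$ is a bijection from $\mathfrak S_n$ onto the set of sub-diagonal sequences of length $n$.
   Context: Permutations are words $\sigma=\sigma(1)\cdots\sigma(n)$. A sequence $(a_1,\ldots,a_n)$ is sub-diagonal if $0\le a_i\le n-i$ for all $i$. Saillance code: $\operatorname{Sc}(\sigma)=(a_1,\ldots,a_n)$ where, if some letter greater than $i$ lies to the left of $i$ in $\sigma$ and $b$ is the rightmost such letter, $a_i=n+1-b$ (the number of letters of $\sigma$ that are $\ge b$); otherwise $a_i=0$. -}

module Defs where

open import Data.Nat using (ℕ; zero; suc; _∸_; _≤_; _<_; _<ᵇ_)
open import Data.Fin using (Fin; toℕ; _≟_)
open import Data.Vec using (Vec; []; _∷_; lookup; tabulate; toList)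
open import Data.List using (List; []; _∷_)
open import Data.Maybe using (Maybe; nothing; just)
open import Data.Bool using (if_then_else_)
open import Relation.Nullary using (yes; no)
open import Relation.Binary.PropositionalEquality using (_≡_)
open import Data.Product using (Σ; _×_)

-- Conventions: the letters 1..n are represented by Fin n, letter k ∈ Fin n
-- standing for the integer toℕ k + 1.  A permutation σ ∈ 𝔖ₙ is a word
-- σ(1)⋯σ(n), i.e. a vector of n letters in which every letter occurs
-- (equivalently positions are mapped injectively).

IsPermutationWord : ∀ {n} → Vec (Fin n) n → Set
IsPermutationWord {n} w = ∀ (p q : Fin n) → lookup w p ≡ lookup w q → p ≡ q

rightmostGreaterBefore : ∀ {n} → Fin n → Maybe (Fin n) → List (Fin n) → Maybe (Fin n)
rightmostGreaterBefore i acc [] = acc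
rightmostGreaterBefore i acc (x ∷ xs) with x ≟ i
... | yes _ = acc
... | no _ = rightmostGreaterBefore i (if toℕ i <ᵇ toℕ x then just x else acc) xs

-- a_i = n + 1 - b with b the (1-based) value of the rightmost greater letter
-- to the left of i; with b = toℕ b' + 1 this is n - toℕ b'.  Otherwise 0.
codeEntry : ∀ {n} → Maybe (Fin n) → ℕ
codeEntry {n} nothing = 0
codeEntry {n} (just b) = n ∸ toℕ b

-- Saillance code Sc(σ) = (a₁,…,aₙ); the i-th entry (0-based index i)
-- corresponds to letter i+1.
Sc : ∀ {n} → Vec (Fin n) n → Vec ℕ n
Sc {n} σ = tabulate (λ i → codeEntry (rightmostGreaterBefore i nothing (toList σ)))

-- Sub-diagonal: 0 ≤ a_i ≤ n - i for 1-based i; with 0-based index j = i-1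
-- this is a_j ≤ n - (toℕ j + 1).
IsSubDiagonal : ∀ {n} → Vec ℕ n → Set
IsSubDiagonal {n} a = ∀ (j : Fin n) → lookup a j ≤ n ∸ suc (toℕ j)

-- Read letters as 0, …, n-1 and write σ≥t for the subword of σ formed by its letters ≥ t.
-- The code entry of the letter i records where i sits in σ≥i: right after b, the rightmost
-- letter greater than i to its left, or at the front if there is none. So σ≥i arises from
-- σ>i by inserting i after b, and σ = σ≥0 is rebuilt from its code by inserting n-1, …, 1, 0
-- in turn into the empty word; this gives injectivity. Conversely, for a sub-diagonal
-- sequence each prescribed b lies among the letters already inserted, so the same insertion
-- process yields a permutation whose code is the given sequence.

module Submission where

open import Defs
open import Data.Nat using (ℕ; zero; suc; _+_; _∸_; _≤_; _<_; _≥_; _<ᵇ_; _≟_; _≤?_; _<?_; z≤n; s≤s)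
open import Data.Nat.Properties
  using ( <ᵇ-reflects-<; ≤-refl; ≤-trans; ≤-antisym; <-irrefl; <-asym; <⇒≤; <⇒≱; ≤⇒≯; ≮⇒≥
        ; m≤n⇒m<n∨m≡n; +-comm; +-suc; +-identityʳ; m≤n+m; m<m+n; m∸n≤m; m+[n∸m]≡n; m∸[m∸n]≡n
        ; m<n⇒0<n∸m; ∸-monoʳ-≤; ∸-monoʳ-<; m+n≤o⇒m≤o∸n; m≤o∸n⇒m+n≤o )
open import Data.Fin as Fin using (Fin; toℕ; fromℕ<)
open import Data.Fin.Properties as FinP
  using (toℕ-injective; toℕ<n; toℕ-fromℕ<; punchOut-injective; injective⇒≤)
open import Data.Vec using (Vec; []; _∷_; lookup; toList; cast)
open import Data.Vec.Properties
  using (lookup∘tabulate; tabulate∘lookup; tabulate-cong; toList-injective; toList-cast; cast-is-id)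
open import Data.List as List using (List; []; _∷_; _++_; _∷ʳ_; length; filter; foldl; initLast; _∷ʳ′_)
open import Data.List.Properties
  using (filter-++; filter-accept; filter-reject; filter-all; filter-none; foldl-∷ʳ; ∷ʳ-++; map-injective)
open import Data.List.Relation.Unary.All as All using (All; []; _∷_)
open import Data.List.Relation.Unary.All.Properties as AllP using ()
open import Data.List.Relation.Unary.Any using (here; there)
open import Data.List.Relation.Unary.AllPairs using ([]; _∷_)
open import Data.List.Relation.Unary.Unique.Propositional using (Unique)
open import Data.List.Relation.Unary.Unique.Propositional.Properties as UniqueP using (Unique[x∷xs]⇒x∉xs)
open import Data.List.Membership.Propositional using (_∈_; _∉_)
open import Data.List.Membership.Propositional.Properties using (∈-∃++; ∈-insert)
open import Data.List.Relation.Binary.Permutation.Propositional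
  using (_↭_; ↭-refl; ↭-prep; ↭-swap; ↭-trans; ↭-sym; ↭⇒↭ₛ)
open import Data.List.Relation.Binary.Permutation.Propositional.Properties using (∈-resp-↭; ↭-length)
open import Data.Maybe as Maybe using (Maybe; nothing; just)
open import Data.Bool using (if_then_else_)
open import Data.Bool.Properties using (if-float)
open import Data.Unit using (⊤; tt)
open import Data.Product using (Σ; ∃; _×_; _,_; proj₁; proj₂)
open import Data.Sum using (inj₁; inj₂)
open import Function using (_∘_)
open import Function.Definitions using (Injective)
open import Relation.Nullary using (yes; no; contradiction)
open import Relation.Nullary.Reflects using (ofʸ; ofⁿ)
open import Relation.Binary.PropositionalEquality
open import Data.List.Relation.Binary.Permutation.Setoid.Properties (setoid ℕ) using (Unique-resp-↭)

unique-++-∷⇒∉ˡ : ∀ {A : Set} {x : A} xs {ys} → Unique (xs ++ x ∷ ys) → x ∉ xs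
unique-++-∷⇒∉ˡ (y ∷ xs) (y≢ ∷ _) (here refl) = All.lookup y≢ (∈-insert xs) refl
unique-++-∷⇒∉ˡ (y ∷ xs) (_ ∷ u)  (there x∈)  = unique-++-∷⇒∉ˡ xs u x∈

unique-++-∷⇒∉ʳ : ∀ {A : Set} {x : A} xs {ys} → Unique (xs ++ x ∷ ys) → x ∉ ys
unique-++-∷⇒∉ʳ []       u       = Unique[x∷xs]⇒x∉xs u
unique-++-∷⇒∉ʳ (y ∷ xs) (_ ∷ u) = unique-++-∷⇒∉ʳ xs u

unique-++⁻ˡ : ∀ {A : Set} (xs : List A) {ys} → Unique (xs ++ ys) → Unique xs
unique-++⁻ˡ []       _          = []
unique-++⁻ˡ (x ∷ xs) (x≢ ∷ u) = AllP.++⁻ˡ xs x≢ ∷ unique-++⁻ˡ xs u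

lastOr : Maybe ℕ → List ℕ → Maybe ℕ
lastOr = foldl (λ _ → just)

rightmostGreater : ℕ → Maybe ℕ → List ℕ → Maybe ℕ
rightmostGreater i acc [] = acc
rightmostGreater i acc (x ∷ xs) with x ≟ i
... | yes _ = acc
... | no _  = rightmostGreater i (if i <ᵇ x then just x else acc) xs

Between : ℕ → ℕ → Maybe ℕ → Set
Between i n nothing  = ⊤
Between i n (just c) = i < c × c < n

rightmostGreater-here : ∀ i acc xs → rightmostGreater i acc (i ∷ xs) ≡ acc
rightmostGreater-here i acc xs with i ≟ i
... | yes _  = refl
... | no i≢i = contradiction refl i≢i

rightmostGreater-smaller : ∀ {i x} acc xs → x < i →
  rightmostGreater i acc (x ∷ xs) ≡ rightmostGreater i acc xs
rightmostGreater-smaller {i} {x} acc xs x<i with x ≟ i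
... | yes refl = contradiction x<i (<-irrefl refl)
... | no _ with i <ᵇ x | <ᵇ-reflects-< i x
...   | _ | ofʸ i<x = contradiction i<x (<-asym x<i)
...   | _ | ofⁿ _   = refl

rightmostGreater-greater : ∀ {i x} acc xs → i < x →
  rightmostGreater i acc (x ∷ xs) ≡ rightmostGreater i (just x) xs
rightmostGreater-greater {i} {x} acc xs i<x with x ≟ i
... | yes refl = contradiction i<x (<-irrefl refl)
... | no _ with i <ᵇ x | <ᵇ-reflects-< i x
...   | _ | ofʸ _   = refl
...   | _ | ofⁿ i≮x = contradiction i<x i≮x

rightmostGreater-∷-cong : ∀ {i} x {xs ys} →
  (∀ acc → rightmostGreater i acc xs ≡ rightmostGreater i acc ys) →
  ∀ acc → rightmostGreater i acc (x ∷ xs) ≡ rightmostGreater i acc (x ∷ ys)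
rightmostGreater-∷-cong {i} x xs≈ys acc with x ≟ i
... | yes _ = refl
... | no _  = xs≈ys _

rightmostGreater-++-∷ : ∀ i acc pre suf → i ∉ pre →
  rightmostGreater i acc (pre ++ i ∷ suf) ≡ lastOr acc (filter (i <?_) pre)
rightmostGreater-++-∷ i acc []        suf _ = rightmostGreater-here i acc suf
rightmostGreater-++-∷ i acc (x ∷ pre) suf i∉ with x ≟ i
... | yes refl = contradiction (here refl) i∉
... | no _ with i <ᵇ x | <ᵇ-reflects-< i x
...   | _ | ofʸ _ = rightmostGreater-++-∷ i (just x) pre suf (i∉ ∘ there)
...   | _ | ofⁿ _ = rightmostGreater-++-∷ i acc pre suf (i∉ ∘ there)

rightmostGreater-between : ∀ {n} i acc xs → All (_< n) xs → Between i n acc →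
  Between i n (rightmostGreater i acc xs)
rightmostGreater-between i acc []       _              b = b
rightmostGreater-between i acc (x ∷ xs) (x<n ∷ xs<n) b with x ≟ i
... | yes _ = b
... | no _ with i <ᵇ x | <ᵇ-reflects-< i x
...   | _ | ofʸ i<x = rightmostGreater-between i (just x) xs xs<n (i<x , x<n)
...   | _ | ofⁿ _   = rightmostGreater-between i acc xs xs<n b

insertAfter : Maybe ℕ → ℕ → List ℕ → List ℕ
insertAfter nothing  x ys = x ∷ ys
insertAfter (just c) x [] = x ∷ []
insertAfter (just c) x (y ∷ ys) with y ≟ c
... | yes _ = y ∷ x ∷ ys
... | no _  = y ∷ insertAfter (just c) x ys

insertAfter-↭ : ∀ b x ys → insertAfter b x ys ↭ x ∷ ys
insertAfter-↭ nothing  x ys = ↭-refl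
insertAfter-↭ (just c) x [] = ↭-refl
insertAfter-↭ (just c) x (y ∷ ys) with y ≟ c
... | yes _ = ↭-swap y x ↭-refl
... | no _  = ↭-trans (↭-prep y (insertAfter-↭ (just c) x ys)) (↭-swap y x ↭-refl)

insertAfter-++-∷ : ∀ x {c} pre suf → c ∉ pre →
  insertAfter (just c) x (pre ++ c ∷ suf) ≡ pre ++ c ∷ x ∷ suf
insertAfter-++-∷ x {c} [] suf _ with c ≟ c
... | yes _  = refl
... | no c≢c = contradiction refl c≢c
insertAfter-++-∷ x {c} (y ∷ pre) suf c∉ with y ≟ c
... | yes refl = contradiction (here refl) c∉
... | no _     = cong (y ∷_) (insertAfter-++-∷ x pre suf (c∉ ∘ there))

insertAfter-lastOr : ∀ x pre suf → Unique pre →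
  insertAfter (lastOr nothing pre) x (pre ++ suf) ≡ pre ++ x ∷ suf
insertAfter-lastOr x pre suf u with initLast pre
... | []           = refl
... | init ∷ʳ′ c = begin
  insertAfter (lastOr nothing (init ∷ʳ c)) x ((init ∷ʳ c) ++ suf)
    ≡⟨ cong₂ (λ b ys → insertAfter b x ys) (foldl-∷ʳ _ nothing c init) (∷ʳ-++ init c suf) ⟩
  insertAfter (just c) x (init ++ c ∷ suf)
    ≡⟨ insertAfter-++-∷ x init suf (unique-++-∷⇒∉ˡ init u) ⟩
  init ++ c ∷ x ∷ suf
    ≡⟨ ∷ʳ-++ init c (x ∷ suf) ⟨
  (init ∷ʳ c) ++ x ∷ suf
    ∎
  where open ≡-Reasoning

filter-≤-∉ : ∀ {i} ys → i ∉ ys → filter (i ≤?_) ys ≡ filter (i <?_) ys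
filter-≤-∉ [] _ = refl
filter-≤-∉ {i} (y ∷ ys) i∉ with i <? y
... | yes i<y = begin
  filter (i ≤?_) (y ∷ ys) ≡⟨ filter-accept (i ≤?_) (<⇒≤ i<y) ⟩
  y ∷ filter (i ≤?_) ys   ≡⟨ cong (y ∷_) (filter-≤-∉ ys (i∉ ∘ there)) ⟩
  y ∷ filter (i <?_) ys   ≡⟨ filter-accept (i <?_) i<y ⟨
  filter (i <?_) (y ∷ ys) ∎
  where open ≡-Reasoning
... | no i≮y = begin
  filter (i ≤?_) (y ∷ ys) ≡⟨ filter-reject (i ≤?_) (λ i≤y → i∉ (here (≤-antisym i≤y (≮⇒≥ i≮y)))) ⟩
  filter (i ≤?_) ys       ≡⟨ filter-≤-∉ ys (i∉ ∘ there) ⟩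
  filter (i <?_) ys       ≡⟨ filter-reject (i <?_) i≮y ⟨
  filter (i <?_) (y ∷ ys) ∎
  where open ≡-Reasoning

filter-≤-insertAfter : ∀ i xs → Unique xs → i ∈ xs →
  filter (i ≤?_) xs ≡ insertAfter (rightmostGreater i nothing xs) i (filter (i <?_) xs)
filter-≤-insertAfter i xs u i∈ with ∈-∃++ i∈
... | pre , suf , refl = begin
  filter (i ≤?_) (pre ++ i ∷ suf)
    ≡⟨ filter-++ (i ≤?_) pre (i ∷ suf) ⟩
  filter (i ≤?_) pre ++ filter (i ≤?_) (i ∷ suf)
    ≡⟨ cong₂ _++_ (filter-≤-∉ pre i∉pre) filter-i∷suf ⟩
  greaterPre ++ i ∷ filter (i <?_) suf
    ≡⟨ insertAfter-lastOr i greaterPre _ (UniqueP.filter⁺ (i <?_) (unique-++⁻ˡ pre u)) ⟨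
  insertAfter (lastOr nothing greaterPre) i (greaterPre ++ filter (i <?_) suf)
    ≡⟨ cong₂ (λ b ys → insertAfter b i ys) (rightmostGreater-++-∷ i nothing pre suf i∉pre) filter-<-split ⟨
  insertAfter (rightmostGreater i nothing (pre ++ i ∷ suf)) i (filter (i <?_) (pre ++ i ∷ suf))
    ∎
  where
    open ≡-Reasoning
    greaterPre = filter (i <?_) pre
    i∉pre = unique-++-∷⇒∉ˡ pre u
    filter-i∷suf : filter (i ≤?_) (i ∷ suf) ≡ i ∷ filter (i <?_) suf
    filter-i∷suf = trans (filter-accept (i ≤?_) ≤-refl)
                         (cong (i ∷_) (filter-≤-∉ suf (unique-++-∷⇒∉ʳ pre u)))
    filter-<-split : filter (i <?_) (pre ++ i ∷ suf) ≡ greaterPre ++ filter (i <?_) suf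
    filter-<-split = trans (filter-++ (i <?_) pre (i ∷ suf))
                           (cong (greaterPre ++_) (filter-reject (i <?_) (<-irrefl refl)))

record IsPermutationList (n : ℕ) (xs : List ℕ) : Set where
  field
    unique   : Unique xs
    bounded  : All (_< n) xs
    complete : ∀ {k} → k < n → k ∈ xs

insertDescending : (ℕ → Maybe ℕ) → ℕ → ℕ → List ℕ
insertDescending β k zero    = []
insertDescending β k (suc m) = insertAfter (β k) k (insertDescending β (suc k) m)

filter-≤-insertDescending : ∀ {n xs β} → IsPermutationList n xs →
  (∀ {i} → i < n → β i ≡ rightmostGreater i nothing xs) →
  ∀ m t → m + t ≡ n → filter (t ≤?_) xs ≡ insertDescending β t m
filter-≤-insertDescending perm _ zero t refl =
  filter-none (t ≤?_) (All.map (λ x<t t≤x → <⇒≱ x<t t≤x) (IsPermutationList.bounded perm))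
filter-≤-insertDescending {n} {xs} {β} perm β≡ (suc m) t m+t≡n = begin
  filter (t ≤?_) xs
    ≡⟨ filter-≤-insertAfter t xs (IsPermutationList.unique perm) (IsPermutationList.complete perm t<n) ⟩
  insertAfter (rightmostGreater t nothing xs) t (filter (t <?_) xs)
    ≡⟨ cong₂ (λ b ys → insertAfter b t ys) (sym (β≡ t<n))
             (filter-≤-insertDescending perm β≡ m (suc t) (trans (+-suc m t) m+t≡n)) ⟩
  insertAfter (β t) t (insertDescending β (suc t) m)
    ∎
  where
    open ≡-Reasoning
    t<n : t < n
    t<n = subst (t <_) m+t≡n (s≤s (m≤n+m t m))

insertDescending-rightmostGreater : ∀ {n xs β} → IsPermutationList n xs →
  (∀ {i} → i < n → β i ≡ rightmostGreater i nothing xs) → insertDescending β 0 n ≡ xs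
insertDescending-rightmostGreater {n} {xs} perm β≡ = begin
  insertDescending _ 0 n ≡⟨ filter-≤-insertDescending perm β≡ n 0 (+-identityʳ n) ⟨
  filter (0 ≤?_) xs      ≡⟨ filter-all (0 ≤?_) (All.universal (λ _ → z≤n) xs) ⟩
  xs                     ∎
  where open ≡-Reasoning

length-insertDescending : ∀ β k m → length (insertDescending β k m) ≡ m
length-insertDescending β k zero    = refl
length-insertDescending β k (suc m) =
  trans (↭-length (insertAfter-↭ (β k) k _)) (cong suc (length-insertDescending β (suc k) m))

∈-insertDescending⁻ : ∀ {β z} k m → z ∈ insertDescending β k m → k ≤ z × z < k + m
∈-insertDescending⁻ {β} {z} k (suc m) z∈ with ∈-resp-↭ (insertAfter-↭ (β k) k _) z∈
... | here refl = ≤-refl , m<m+n k (s≤s z≤n)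
... | there z∈′ with ∈-insertDescending⁻ (suc k) m z∈′
...   | k<z , z<k+1+m = <⇒≤ k<z , subst (z <_) (sym (+-suc k m)) z<k+1+m

∈-insertDescending⁺ : ∀ {β z} k m → k ≤ z → z < k + m → z ∈ insertDescending β k m
∈-insertDescending⁺ {z = z} k zero k≤z z<k+0 =
  contradiction (subst (z <_) (+-identityʳ k) z<k+0) (≤⇒≯ k≤z)
∈-insertDescending⁺ {β} {z} k (suc m) k≤z z<k+1+m = ∈-resp-↭ (↭-sym (insertAfter-↭ (β k) k _)) z∈k∷
  where
    z∈k∷ : z ∈ k ∷ insertDescending β (suc k) m
    z∈k∷ with m≤n⇒m<n∨m≡n k≤z
    ... | inj₁ k<z  = there (∈-insertDescending⁺ (suc k) m k<z (subst (z <_) (+-suc k m) z<k+1+m))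
    ... | inj₂ refl = here refl

unique-insertDescending : ∀ β k m → Unique (insertDescending β k m)
unique-insertDescending β k zero    = []
unique-insertDescending β k (suc m) = Unique-resp-↭ (↭⇒↭ₛ (↭-sym (insertAfter-↭ (β k) k _)))
  (All.tabulate k∉ ∷ unique-insertDescending β (suc k) m)
  where
    k∉ : ∀ {z} → z ∈ insertDescending β (suc k) m → k ≢ z
    k∉ z∈ k≡z = <-irrefl k≡z (proj₁ (∈-insertDescending⁻ (suc k) m z∈))

rightmostGreater-insertAfter-smaller : ∀ {i x} b acc ys → x < i →
  rightmostGreater i acc (insertAfter b x ys) ≡ rightmostGreater i acc ys
rightmostGreater-insertAfter-smaller nothing  acc ys x<i = rightmostGreater-smaller acc ys x<i
rightmostGreater-insertAfter-smaller (just c) acc [] x<i = rightmostGreater-smaller acc [] x<i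
rightmostGreater-insertAfter-smaller (just c) acc (y ∷ ys) x<i with y ≟ c
... | yes _ = rightmostGreater-∷-cong y (λ acc′ → rightmostGreater-smaller acc′ ys x<i) acc
... | no _  = rightmostGreater-∷-cong y (λ acc′ → rightmostGreater-insertAfter-smaller (just c) acc′ ys x<i) acc

rightmostGreater-insertAfter-self : ∀ {i c} acc ys → c ∈ ys → All (i <_) ys →
  rightmostGreater i acc (insertAfter (just c) i ys) ≡ just c
rightmostGreater-insertAfter-self {i} {c} acc (y ∷ ys) c∈ (i<y ∷ i<ys) with y ≟ c
... | yes refl = trans (rightmostGreater-greater acc (i ∷ ys) i<y) (rightmostGreater-here i (just y) ys)
... | no y≢c with c∈
...   | here c≡y   = contradiction (sym c≡y) y≢c
...   | there c∈ys = trans (rightmostGreater-greater acc _ i<y)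
                           (rightmostGreater-insertAfter-self (just y) ys c∈ys i<ys)

rightmostGreater-insertDescending-shift : ∀ {β i} acc d k m → d + k ≡ i →
  rightmostGreater i acc (insertDescending β k (d + m)) ≡ rightmostGreater i acc (insertDescending β i m)
rightmostGreater-insertDescending-shift acc zero k m refl = refl
rightmostGreater-insertDescending-shift {β} acc (suc d) k m d+k≡i =
  trans (rightmostGreater-insertAfter-smaller (β k) acc _ k<i)
        (rightmostGreater-insertDescending-shift acc d (suc k) m (trans (+-suc d k) d+k≡i))
  where
    k<i = subst (k <_) d+k≡i (s≤s (m≤n+m k d))

rightmostGreater-insertDescending : ∀ {n β} → (∀ {i} → i < n → Between i n (β i)) →
  ∀ {i} → i < n → rightmostGreater i nothing (insertDescending β 0 n) ≡ β i
rightmostGreater-insertDescending {n} {β} between {i} i<n = begin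
  rightmostGreater i nothing (insertDescending β 0 n)
    ≡⟨ cong (rightmostGreater i nothing ∘ insertDescending β 0) (trans (+-suc i m) 1+i+m≡n) ⟨
  rightmostGreater i nothing (insertDescending β 0 (i + suc m))
    ≡⟨ rightmostGreater-insertDescending-shift nothing i 0 (suc m) (+-identityʳ i) ⟩
  rightmostGreater i nothing (insertAfter (β i) i greater)
    ≡⟨ insertedAfter (β i) (between i<n) ⟩
  β i
    ∎
  where
    open ≡-Reasoning
    m = n ∸ suc i
    1+i+m≡n : suc i + m ≡ n
    1+i+m≡n = m+[n∸m]≡n i<n
    greater = insertDescending β (suc i) m
    insertedAfter : ∀ b → Between i n b → rightmostGreater i nothing (insertAfter b i greater) ≡ b
    insertedAfter nothing  _           = rightmostGreater-here i nothing greater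
    insertedAfter (just c) (i<c , c<n) = rightmostGreater-insertAfter-self nothing greater
      (∈-insertDescending⁺ (suc i) m i<c (subst (c <_) (sym 1+i+m≡n) c<n))
      (All.tabulate (proj₁ ∘ ∈-insertDescending⁻ (suc i) m))

codeValue : ℕ → Maybe ℕ → ℕ
codeValue n nothing  = 0
codeValue n (just b) = n ∸ b

decodeValue : ℕ → ℕ → Maybe ℕ
decodeValue n zero    = nothing
decodeValue n (suc v) = just (n ∸ suc v)

codeValue-between : ∀ {i n} b → Between i n b → codeValue n b ≤ n ∸ suc i
codeValue-between          nothing  _         = z≤n
codeValue-between {n = n} (just b) (i<b , _) = ∸-monoʳ-≤ n i<b

decodeValue-codeValue : ∀ {i n} b → Between i n b → decodeValue n (codeValue n b) ≡ b
decodeValue-codeValue nothing _ = refl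
decodeValue-codeValue {n = n} (just b) (_ , b<n) with n ∸ b in n∸b≡
... | zero  = contradiction (subst (0 <_) n∸b≡ (m<n⇒0<n∸m b<n)) (<-irrefl refl)
... | suc v = cong just (trans (cong (n ∸_) (sym n∸b≡)) (m∸[m∸n]≡n (<⇒≤ b<n)))

codeValue-decodeValue : ∀ {n} v → v ≤ n → codeValue n (decodeValue n v) ≡ v
codeValue-decodeValue zero    _   = refl
codeValue-decodeValue (suc v) v<n = m∸[m∸n]≡n v<n

decodeValue-between : ∀ {i n} v → i < n → v ≤ n ∸ suc i → Between i n (decodeValue n v)
decodeValue-between zero _ _ = tt
decodeValue-between {i} {n} (suc v) i<n v≤ = i<n∸v , ∸-monoʳ-< (s≤s z≤n) v<n
  where
    v<n : suc v ≤ n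
    v<n = ≤-trans v≤ (m∸n≤m n (suc i))
    i<n∸v : i < n ∸ suc v
    i<n∸v = m+n≤o⇒m≤o∸n (suc i)
              (subst (_≤ n) (+-comm (suc v) (suc i)) (m≤o∸n⇒m+n≤o (suc v) i<n v≤))

letters : ∀ {n m} → Vec (Fin n) m → List ℕ
letters v = List.map toℕ (toList v)

map-rightmostGreaterBefore : ∀ {n} (i : Fin n) acc xs →
  Maybe.map toℕ (rightmostGreaterBefore i acc xs)
    ≡ rightmostGreater (toℕ i) (Maybe.map toℕ acc) (List.map toℕ xs)
map-rightmostGreaterBefore i acc [] = refl
map-rightmostGreaterBefore i acc (x ∷ xs) with x Fin.≟ i | toℕ x ≟ toℕ i
... | yes _   | yes _   = refl
... | yes x≡i | no x≢i  = contradiction (cong toℕ x≡i) x≢i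
... | no x≢i  | yes x≡i = contradiction (toℕ-injective x≡i) x≢i
... | no _    | no _    = trans (map-rightmostGreaterBefore i _ xs)
  (cong (λ acc′ → rightmostGreater (toℕ i) acc′ (List.map toℕ xs))
        (if-float (Maybe.map toℕ) (toℕ i <ᵇ toℕ x)))

codeEntry-codeValue : ∀ {n} (b : Maybe (Fin n)) → codeEntry b ≡ codeValue n (Maybe.map toℕ b)
codeEntry-codeValue nothing  = refl
codeEntry-codeValue (just b) = refl

codeEntry-letters : ∀ {n} (σ : Vec (Fin n) n) i →
  codeEntry (rightmostGreaterBefore i nothing (toList σ))
    ≡ codeValue n (rightmostGreater (toℕ i) nothing (letters σ))
codeEntry-letters {n} σ i = trans (codeEntry-codeValue (rightmostGreaterBefore i nothing (toList σ)))
                                  (cong (codeValue n) (map-rightmostGreaterBefore i nothing (toList σ)))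

lookup-Sc : ∀ {n} (σ : Vec (Fin n) n) i →
  lookup (Sc σ) i ≡ codeValue n (rightmostGreater (toℕ i) nothing (letters σ))
lookup-Sc σ i = trans (lookup∘tabulate _ i) (codeEntry-letters σ i)

letters-bounded : ∀ {n m} (v : Vec (Fin n) m) → All (_< n) (letters v)
letters-bounded v = AllP.map⁺ (All.universal toℕ<n (toList v))

Sc-isSubDiagonal : ∀ {n} (σ : Vec (Fin n) n) → IsSubDiagonal (Sc σ)
Sc-isSubDiagonal {n} σ j = subst (_≤ n ∸ suc (toℕ j)) (sym (lookup-Sc σ j))
  (codeValue-between _ (rightmostGreater-between (toℕ j) nothing (letters σ) (letters-bounded σ) tt))

lookup∈letters : ∀ {n m} (v : Vec (Fin n) m) p → toℕ (lookup v p) ∈ letters v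
lookup∈letters (x ∷ v) Fin.zero    = here refl
lookup∈letters (x ∷ v) (Fin.suc p) = there (lookup∈letters v p)

∈-letters⁻ : ∀ {n m k} (v : Vec (Fin n) m) → k ∈ letters v → ∃ λ p → toℕ (lookup v p) ≡ k
∈-letters⁻ (x ∷ v) (here k≡x) = Fin.zero , sym k≡x
∈-letters⁻ (x ∷ v) (there k∈) with ∈-letters⁻ v k∈
... | p , x≡k = Fin.suc p , x≡k

letters-unique : ∀ {n m} (v : Vec (Fin n) m) → Injective _≡_ _≡_ (lookup v) → Unique (letters v)
letters-unique []      _   = []
letters-unique (x ∷ v) inj = All.tabulate x∉ ∷ letters-unique v (FinP.suc-injective ∘ inj)
  where
    x∉ : ∀ {k} → k ∈ letters v → toℕ x ≢ k
    x∉ k∈ x≡k with ∈-letters⁻ v k∈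
    ... | p , p≡k with inj {Fin.zero} {Fin.suc p} (toℕ-injective (trans x≡k (sym p≡k)))
    ...   | ()

letters-unique⇒injective : ∀ {n m} (v : Vec (Fin n) m) → Unique (letters v) →
  Injective _≡_ _≡_ (lookup v)
letters-unique⇒injective (x ∷ v) _        {Fin.zero}  {Fin.zero}  _  = refl
letters-unique⇒injective (x ∷ v) (x∉ ∷ _) {Fin.zero}  {Fin.suc q} x≡ =
  contradiction (cong toℕ x≡) (All.lookup x∉ (lookup∈letters v q))
letters-unique⇒injective (x ∷ v) (x∉ ∷ _) {Fin.suc p} {Fin.zero}  ≡x =
  contradiction (cong toℕ (sym ≡x)) (All.lookup x∉ (lookup∈letters v p))
letters-unique⇒injective (x ∷ v) (_ ∷ u)  {Fin.suc p} {Fin.suc q} eq =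
  cong Fin.suc (letters-unique⇒injective v u eq)

letters-injective : ∀ {n m} (v w : Vec (Fin n) m) → letters v ≡ letters w → v ≡ w
letters-injective v w eq =
  trans (sym (cast-is-id refl v)) (toList-injective refl v w (map-injective toℕ-injective eq))

permutationWord-surjective : ∀ {n} (σ : Vec (Fin n) n) → IsPermutationWord σ →
  ∀ j → ∃ λ p → lookup σ p ≡ j
permutationWord-surjective {suc n} σ perm j with FinP.any? (λ p → lookup σ p Fin.≟ j)
... | yes hit = hit
... | no miss = contradiction (injective⇒≤ avoidJ-injective) (<-irrefl refl)
  where
    avoidJ : Fin (suc n) → Fin n
    avoidJ p = Fin.punchOut {i = j} {j = lookup σ p} (λ j≡ → miss (p , sym j≡))
    avoidJ-injective : Injective _≡_ _≡_ avoidJ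
    avoidJ-injective {p} {q} eq = perm p q (punchOut-injective {i = j} _ _ eq)

isPermutationList-letters : ∀ {n} (σ : Vec (Fin n) n) → IsPermutationWord σ →
  IsPermutationList n (letters σ)
isPermutationList-letters σ perm = record
  { unique   = letters-unique σ (λ {p} {q} → perm p q)
  ; bounded  = letters-bounded σ
  ; complete = complete
  }
  where
    complete : ∀ {k} → k < _ → k ∈ letters σ
    complete k<n with permutationWord-surjective σ perm (fromℕ< k<n)
    ... | p , σp≡k = subst (_∈ letters σ) (trans (cong toℕ σp≡k) (toℕ-fromℕ< k<n)) (lookup∈letters σ p)

fromLetters : ∀ {n} (ys : List ℕ) → All (_< n) ys → Vec (Fin n) (length ys)
fromLetters []       []             = []
fromLetters (y ∷ ys) (y<n ∷ ys<n) = fromℕ< y<n ∷ fromLetters ys ys<n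

letters-fromLetters : ∀ {n} (ys : List ℕ) (ys<n : All (_< n) ys) → letters (fromLetters ys ys<n) ≡ ys
letters-fromLetters []       []             = refl
letters-fromLetters (y ∷ ys) (y<n ∷ ys<n) = cong₂ _∷_ (toℕ-fromℕ< y<n) (letters-fromLetters ys ys<n)

-- Indices past the end give 0.
entry : ∀ {n} → Vec ℕ n → ℕ → ℕ
entry []      k       = 0
entry (x ∷ a) zero    = x
entry (x ∷ a) (suc k) = entry a k

entry-toℕ : ∀ {n} (a : Vec ℕ n) i → entry a (toℕ i) ≡ lookup a i
entry-toℕ (x ∷ a) Fin.zero    = refl
entry-toℕ (x ∷ a) (Fin.suc i) = entry-toℕ a i

entry-fromℕ< : ∀ {n k} (a : Vec ℕ n) (k<n : k < n) → entry a k ≡ lookup a (fromℕ< k<n)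
entry-fromℕ< a k<n = trans (cong (entry a) (sym (toℕ-fromℕ< k<n))) (entry-toℕ a (fromℕ< k<n))

entry-Sc : ∀ {n i} (σ : Vec (Fin n) n) → i < n →
  entry (Sc σ) i ≡ codeValue n (rightmostGreater i nothing (letters σ))
entry-Sc {n} {i} σ i<n = begin
  entry (Sc σ) i                                                        ≡⟨ entry-fromℕ< (Sc σ) i<n ⟩
  lookup (Sc σ) (fromℕ< i<n)                                            ≡⟨ lookup-Sc σ (fromℕ< i<n) ⟩
  codeValue n (rightmostGreater (toℕ (fromℕ< i<n)) nothing (letters σ))
    ≡⟨ cong (λ k → codeValue n (rightmostGreater k nothing (letters σ))) (toℕ-fromℕ< i<n) ⟩
  codeValue n (rightmostGreater i nothing (letters σ))                  ∎
  where open ≡-Reasoning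

decodeLetters : ∀ {n} → Vec ℕ n → List ℕ
decodeLetters {n} a = insertDescending (decodeValue n ∘ entry a) 0 n

decode : ∀ {n} → Vec ℕ n → Vec (Fin n) n
decode {n} a = cast (length-insertDescending _ 0 n) (fromLetters (decodeLetters a) bounded)
  where
    bounded : All (_< n) (decodeLetters a)
    bounded = All.tabulate (proj₂ ∘ ∈-insertDescending⁻ 0 n)

letters-decode : ∀ {n} (a : Vec ℕ n) → letters (decode a) ≡ decodeLetters a
letters-decode a = trans (cong (List.map toℕ) (toList-cast _ _)) (letters-fromLetters _ _)

decode-isPermutationWord : ∀ {n} (a : Vec ℕ n) → IsPermutationWord (decode a)
decode-isPermutationWord {n} a p q = letters-unique⇒injective (decode a)
  (subst Unique (sym (letters-decode a)) (unique-insertDescending _ 0 n))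

decode-Sc : ∀ {n} (σ : Vec (Fin n) n) → IsPermutationWord σ → decode (Sc σ) ≡ σ
decode-Sc {n} σ perm = letters-injective _ _ (begin
  letters (decode (Sc σ)) ≡⟨ letters-decode (Sc σ) ⟩
  decodeLetters (Sc σ)    ≡⟨ insertDescending-rightmostGreater (isPermutationList-letters σ perm) decodedEntry ⟩
  letters σ               ∎)
  where
    open ≡-Reasoning
    decodedEntry : ∀ {i} → i < n → decodeValue n (entry (Sc σ) i) ≡ rightmostGreater i nothing (letters σ)
    decodedEntry {i} i<n = trans (cong (decodeValue n) (entry-Sc σ i<n))
      (decodeValue-codeValue _ (rightmostGreater-between i nothing (letters σ) (letters-bounded σ) tt))

Sc-decode : ∀ {n} (a : Vec ℕ n) → IsSubDiagonal a → Sc (decode a) ≡ a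
Sc-decode {n} a subDiagonal = trans (tabulate-cong decodedEntry) (tabulate∘lookup a)
  where
    open ≡-Reasoning
    entry≤ : ∀ {k} → k < n → entry a k ≤ n ∸ suc k
    entry≤ {k} k<n = subst₂ (λ e j → e ≤ n ∸ suc j) (sym (entry-fromℕ< a k<n)) (toℕ-fromℕ< k<n)
                            (subDiagonal (fromℕ< k<n))
    decodedEntry : ∀ i → codeEntry (rightmostGreaterBefore i nothing (toList (decode a))) ≡ lookup a i
    decodedEntry i = begin
      codeEntry (rightmostGreaterBefore i nothing (toList (decode a)))
        ≡⟨ codeEntry-letters (decode a) i ⟩
      codeValue n (rightmostGreater (toℕ i) nothing (letters (decode a)))
        ≡⟨ cong (codeValue n ∘ rightmostGreater (toℕ i) nothing) (letters-decode a) ⟩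
      codeValue n (rightmostGreater (toℕ i) nothing (decodeLetters a))
        ≡⟨ cong (codeValue n) (rightmostGreater-insertDescending (λ k<n → decodeValue-between _ k<n (entry≤ k<n))
                                                                (toℕ<n i)) ⟩
      codeValue n (decodeValue n (entry a (toℕ i)))
        ≡⟨ codeValue-decodeValue _ (≤-trans (entry≤ (toℕ<n i)) (m∸n≤m n (suc (toℕ i)))) ⟩
      entry a (toℕ i)
        ≡⟨ entry-toℕ a i ⟩
      lookup a i
        ∎

Sc-injective : ∀ {n} (σ τ : Vec (Fin n) n) → IsPermutationWord σ → IsPermutationWord τ →
  Sc σ ≡ Sc τ → σ ≡ τ
Sc-injective σ τ σ-perm τ-perm Sc≡ = begin
  σ             ≡⟨ decode-Sc σ σ-perm ⟨
  decode (Sc σ) ≡⟨ cong decode Sc≡ ⟩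
  decode (Sc τ) ≡⟨ decode-Sc τ τ-perm ⟩
  τ             ∎
  where open ≡-Reasoning

mainTheorem6 : (n : ℕ) → n ≥ 1 →
    (∀ (σ : Vec (Fin n) n) → IsPermutationWord σ → IsSubDiagonal (Sc σ))
    × (∀ (σ τ : Vec (Fin n) n) → IsPermutationWord σ → IsPermutationWord τ → Sc σ ≡ Sc τ → σ ≡ τ)
    × (∀ (a : Vec ℕ n) → IsSubDiagonal a → Σ (Vec (Fin n) n) (λ σ → IsPermutationWord σ × Sc σ ≡ a))
mainTheorem6 n _ =
    (λ σ _ → Sc-isSubDiagonal σ)
  , Sc-injective
  , (λ a subDiagonal → decode a , decode-isPermutationWord a , Sc-decode a subDiagonal)
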